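{- Let $\mathcal{S}$ be the rule system consisting of the rules HYP, JUST, $\to$I, $\to$E, $\mathsf{E}$I, $\mathsf{E}$E, the structural rules of weakening (from $\Gamma\vdash\gamma\ \star$ infer $\Gamma,\varphi\ \mathit{true}\vdash\gamma\ \star$), exchange (from $\Gamma,\varphi\ \mathit{true},\psi\ \mathit{true}\vdash\gamma\ \star$ infer $\Gamma,\psi\ \mathit{true},\varphi\ \mathit{true}\vdash\gamma\ \star$) and contraction (from $\Gamma,\varphi\ \mathit{true},\varphi\ \mathit{true}\vdash\gamma\ \star$ infer $\Gamma,\varphi\ \mathit{true}\vdash\gamma\ \star$), where $\star$ is $\mathit{true}$ or $\mathit{just\ true}$, and the rule (R): from $\Gamma\vdash\varphi\to\mathsf{E}\psi\ \mathit{true}$ infer $\Gamma\vdash\varphi\to\psi\ \mathit{just\ true}$. Then each of the following rules is derivable in $\mathcal{S}$: ($\to$Ij) from $\Gamma,\varphi\ \mathit{true}\vdash\psi\ \mathit{just\ true}$ infer $\Gamma\vdash\varphi\to\psi\ \mathit{just\ true}$; ($\to$Ej) from $\Gamma\vdash\varphi\to\psi\ \mathit{just\ true}$ and $\Gamma\vdash\varphi\ \mathit{true}$ infer $\Gamma\vdash\psi\ \mathit{just\ true}$; ($\mathsf{E}$Ij) from $\Gamma\vdash\varphi\ \mathit{just\ true}$ infer $\Gamma\vdash\mathsf{E}\varphi\ \mathit{just\ true}$; ($\mathsf{E}$Ej) from $\Gamma\vdash\mathsf{E}\varphi\ \mathit{just\ true}$ and $\Gamma,\varphi\ \mathit{true}\vdash\gamma\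 \mathit{just\ true}$ infer $\Gamma\vdash\gamma\ \mathit{just\ true}$.
   Context: Propositions are generated by $\varphi ::= p \mid \varphi\to\psi \mid \mathsf{E}\varphi$, where $p$ ranges over atomic propositions and $\mathsf{E}$ is a unary "existence" modality. A context $\Gamma$ is a finite list $\varphi_1\ \mathit{true},\dots,\varphi_n\ \mathit{true}$. Judgments have the forms $\Gamma\vdash\varphi\ \mathit{true}$ and $\Gamma\vdash\varphi\ \mathit{just\ true}$. The basic rules are: (HYP) $\Gamma,\varphi\ \mathit{true}\vdash\varphi\ \mathit{true}$; (JUST) from $\Gamma\vdash\varphi\ \mathit{true}$ infer $\Gamma\vdash\varphi\ \mathit{just\ true}$; ($\to$I) from $\Gamma,\varphi\ \mathit{true}\vdash\psi\ \mathit{true}$ infer $\Gamma\vdash\varphi\to\psi\ \mathit{true}$; ($\to$E) from $\Gamma\vdash\varphi\to\psi\ \mathit{true}$ and $\Gamma\vdash\varphi\ \mathit{true}$ infer $\Gamma\vdash\psi\ \mathit{true}$; ($\mathsf{E}$I) from $\Gamma\vdash\varphi\ \mathit{just\ true}$ infer $\Gamma\vdash\mathsf{E}\varphi\ \mathit{true}$; ($\mathsf{E}$E) from $\Gamma\vdash\mathsf{E}\varphi\ \mathit{true}$ and $\Gamma,\varphi\ \mathit{true}\vdash\gamma\ \mathit{just\ true}$ infer $\Gamma\vdash\gamma\ \mathit{just\ true}$. A rule is derivable in a system if its conclusion can be derived in the system from its premises taken as additional axioms. -}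

module Defs where

open import Data.Nat using (ℕ)
open import Data.List using (List; []; _∷_)
open import Data.Sum using (_⊎_)
open import Relation.Binary.PropositionalEquality using (_≡_)

infixr 7 _⇒_

data Form : Set where
  atom : ℕ → Form
  _⇒_  : Form → Form → Form
  E    : Form → Form

-- Context Γ = φ₁ true, …, φₙ true ; the list HEAD is the RIGHTMOST entry,
-- so "Γ , φ true" is  φ ∷ Γ.
Ctx : Set
Ctx = List Form

data Mode : Set where
  true just : Mode

data Judgment : Set where
  _⊢_∶_ : Ctx → Form → Mode → Judgment

-- Derivability in the system S from an extra set of axioms `Ax`
-- (premises of a rule taken as additional axioms).
data S (Ax : Judgment → Set) : Judgment → Set where
  axiom  : ∀ {J} → Ax J → S Ax J
  hyp    : ∀ {Γ φ} → S Ax ((φ ∷ Γ) ⊢ φ ∶ true)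
  justR  : ∀ {Γ φ} → S Ax (Γ ⊢ φ ∶ true) → S Ax (Γ ⊢ φ ∶ just)
  ⇒I     : ∀ {Γ φ ψ} → S Ax ((φ ∷ Γ) ⊢ ψ ∶ true) → S Ax (Γ ⊢ (φ ⇒ ψ) ∶ true)
  ⇒E     : ∀ {Γ φ ψ} → S Ax (Γ ⊢ (φ ⇒ ψ) ∶ true) → S Ax (Γ ⊢ φ ∶ true)
           → S Ax (Γ ⊢ ψ ∶ true)
  EI     : ∀ {Γ φ} → S Ax (Γ ⊢ φ ∶ just) → S Ax (Γ ⊢ E φ ∶ true)
  EE     : ∀ {Γ φ γ} → S Ax (Γ ⊢ E φ ∶ true) → S Ax ((φ ∷ Γ) ⊢ γ ∶ just)
           → S Ax (Γ ⊢ γ ∶ just)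
  weak   : ∀ {Γ φ γ ⋆} → S Ax (Γ ⊢ γ ∶ ⋆) → S Ax ((φ ∷ Γ) ⊢ γ ∶ ⋆)
  exch   : ∀ {Γ φ ψ γ ⋆} → S Ax ((ψ ∷ φ ∷ Γ) ⊢ γ ∶ ⋆)
           → S Ax ((φ ∷ ψ ∷ Γ) ⊢ γ ∶ ⋆)
  contr  : ∀ {Γ φ γ ⋆} → S Ax ((φ ∷ φ ∷ Γ) ⊢ γ ∶ ⋆) → S Ax ((φ ∷ Γ) ⊢ γ ∶ ⋆)
  R      : ∀ {Γ φ ψ} → S Ax (Γ ⊢ (φ ⇒ E ψ) ∶ true) → S Ax (Γ ⊢ (φ ⇒ ψ) ∶ just)

One : Judgment → Judgment → Set
One P J = J ≡ P

Two : Judgment → Judgment → Judgment → Set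
Two P Q J = J ≡ P ⊎ J ≡ Q

Derivable : (Judgment → Set) → Judgment → Set
Derivable Ax C = S Ax C

{-# OPTIONS --safe #-}
-- A "just true" judgment can be cut against a hypothesis whose conclusion is
-- again "just true": EI packs it into E φ true and EE unpacks it. Hence the
-- elimination rules and EIj hold for "just true" premises as soon as they hold
-- for "true" ones, while →Ij is the one place where the rule R is needed.
module Submission where

open import Defs
open import Data.Product using (_×_; _,_)
open import Data.List using (_∷_)
open import Data.Sum using (inj₁; inj₂)
open import Relation.Binary.PropositionalEquality using (refl)

private
  variable
    Ax : Judgment → Set
    Γ : Ctx
    φ ψ γ : Form

cut-just : S Ax (Γ ⊢ φ ∶ just) → S Ax ((φ ∷ Γ) ⊢ γ ∶ just) → S Ax (Γ ⊢ γ ∶ just)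
cut-just d e = EE (EI d) e

E-left : S Ax ((φ ∷ Γ) ⊢ γ ∶ just) → S Ax ((E φ ∷ Γ) ⊢ γ ∶ just)
E-left d = EE hyp (exch (weak d))

⇒Ij : S Ax ((φ ∷ Γ) ⊢ ψ ∶ just) → S Ax (Γ ⊢ (φ ⇒ ψ) ∶ just)
⇒Ij d = R (⇒I (EI d))

⇒Ej : S Ax (Γ ⊢ (φ ⇒ ψ) ∶ just) → S Ax (Γ ⊢ φ ∶ true) → S Ax (Γ ⊢ ψ ∶ just)
⇒Ej d e = cut-just d (justR (⇒E hyp (weak e)))

EIj : S Ax (Γ ⊢ φ ∶ just) → S Ax (Γ ⊢ E φ ∶ just)
EIj d = justR (EI d)

EEj : S Ax (Γ ⊢ E φ ∶ just) → S Ax ((φ ∷ Γ) ⊢ γ ∶ just) → S Ax (Γ ⊢ γ ∶ just)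
EEj d e = cut-just d (E-left e)

proposition10 :
    -- (→Ij)
    (∀ Γ φ ψ → Derivable (One ((φ ∷ Γ) ⊢ ψ ∶ just)) (Γ ⊢ (φ ⇒ ψ) ∶ just))
    -- (→Ej)
    × (∀ Γ φ ψ → Derivable (Two (Γ ⊢ (φ ⇒ ψ) ∶ just) (Γ ⊢ φ ∶ true)) (Γ ⊢ ψ ∶ just))
    -- (EIj)
    × (∀ Γ φ → Derivable (One (Γ ⊢ φ ∶ just)) (Γ ⊢ E φ ∶ just))
    -- (EEj)
    × (∀ Γ φ γ → Derivable (Two (Γ ⊢ E φ ∶ just) ((φ ∷ Γ) ⊢ γ ∶ just)) (Γ ⊢ γ ∶ just))
proposition10 =
    (λ _ _ _ → ⇒Ij (axiom refl))
  , (λ _ _ _ → ⇒Ej (axiom (inj₁ refl)) (axiom (inj₂ refl)))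
  , (λ _ _ → EIj (axiom refl))
  , (λ _ _ _ → EEj (axiom (inj₁ refl)) (axiom (inj₂ refl)))
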